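{- Let $f_1,f_2\in V$ and $\mathcal{C}=\langle f_1,f_2\rangle_{q^n}$ be such that $L\in\mathcal{L}_\mathcal{C}$ is a proper $\mathbb{F}_q$-linear set of rank $n$ in $\mathrm{PG}(1,q^n)$, and let $A_i$ denote the number of elements of rank $i$ in $\mathcal{C}$. Then \[A_{n-1}=\frac{(q^n-1)^2}{q-1}-\sum_{i=0}^{n-2}A_i\begin{bmatrix} n-i\\ 1\end{bmatrix}_q+\begin{bmatrix} n\\ 1\end{bmatrix}_q.\]
   Context: $V=\mathrm{End}_{\mathbb{F}_q}(\mathbb{F}_{q^n})$ as an $\mathbb{F}_{q^n}$-vector space (linearised polynomials); rank means rank as an $\mathbb{F}_q$-linear map (so $A_0=1$). $\mathcal{L}_\mathcal{C}$ is the set of linear sets $L_{g_1,g_2}=\{(g_1(x),g_2(x))_{q^n}:x\in\mathbb{F}_{q^n}^*\}$ over all $\mathbb{F}_{q^n}$-bases $g_1,g_2$ of $\mathcal{C}$. A linear set is proper if it contains more than one point. $\begin{bmatrix} m\\ 1\end{bmatrix}_q=(q^m-1)/(q-1)$. -}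

module Defs where

open import Level using (0ℓ)
open import Data.Nat as ℕ using (ℕ; zero; suc; _∸_; _^_)
open import Data.Integer as ℤ using (ℤ; +_)
open import Data.List using (List; []; _∷_; map; filter; length; deduplicate; concatMap; upTo)
open import Data.List.Properties as LP using ()
open import Data.Product using (Σ; ∃; _×_; _,_)
open import Data.Product.Properties as PP using ()
open import Data.Empty using (⊥)
open import Data.List.Membership.Propositional using (_∈_)
open import Data.List.Relation.Unary.Unique.Propositional using (Unique)
open import Relation.Nullary using (¬_; Dec)
open import Relation.Binary.PropositionalEquality using (_≡_; _≢_)
open import Relation.Binary.Definitions using (DecidableEquality)
open import Algebra.Structures using (IsCommutativeRing)

record FiniteField : Set₁ where
  infixl 6 _+_
  infixl 7 _*_
  field
    Carrier  : Set
    _≟_      : DecidableEquality Carrier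
    _+_ _*_  : Carrier → Carrier → Carrier
    -_       : Carrier → Carrier
    0# 1#    : Carrier
    isCommutativeRing : IsCommutativeRing _≡_ _+_ _*_ -_ 0# 1#
    0≢1      : 0# ≢ 1#
    inverse  : ∀ x → x ≢ 0# → Σ Carrier (λ y → x * y ≡ 1#)
    elements : List Carrier
    complete : ∀ x → x ∈ elements
    unique   : Unique elements

  size : ℕ
  size = length elements

record Subfield (K : FiniteField) : Set₁ where
  open FiniteField K
  field
    In    : Carrier → Set
    In?   : ∀ x → Dec (In x)
    has0  : In 0#
    has1  : In 1#
    +-cl  : ∀ {x y} → In x → In y → In (x + y)
    *-cl  : ∀ {x y} → In x → In y → In (x * y)
    neg-cl : ∀ {x} → In x → In (- x)
    inv-cl : ∀ {x y} → In x → x * y ≡ 1# → In y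

  subSize : ℕ
  subSize = length (filter In? elements)

module _ (K : FiniteField) where
  open FiniteField K

  card : List Carrier → ℕ
  card xs = length (deduplicate _≟_ xs)

  -- value table of a map K → K (determines the map, since `elements`
  -- enumerates K)
  table : (Carrier → Carrier) → List Carrier
  table h = map h elements

  module _ (F : Subfield K) where
    open Subfield F

    -- h is F-linear, i.e. an element of V = End_{F}(K)
    IsFLinear : (Carrier → Carrier) → Set
    IsFLinear h = (∀ x y → h (x + y) ≡ h x + h y)
                × (∀ c x → In c → h (c * x) ≡ c * h x)

  lin : Carrier → (Carrier → Carrier) → Carrier → (Carrier → Carrier)
      → Carrier → Carrier
  lin a g₁ b g₂ x = a * g₁ x + b * g₂ x

  InSpan : (Carrier → Carrier) → (Carrier → Carrier) → (Carrier → Carrier) → Set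
  InSpan g₁ g₂ h = Σ Carrier λ a → Σ Carrier λ b → ∀ x → h x ≡ lin a g₁ b g₂ x

  IsBasisOf : (f₁ f₂ g₁ g₂ : Carrier → Carrier) → Set
  IsBasisOf f₁ f₂ g₁ g₂ =
      InSpan f₁ f₂ g₁ × InSpan f₁ f₂ g₂
    × (∀ a b → InSpan g₁ g₂ (lin a f₁ b f₂))
    × (∀ a b → (∀ x → lin a g₁ b g₂ x ≡ 0#) → (a ≡ 0#) × (b ≡ 0#))

  SamePoint : (g₁ g₂ : Carrier → Carrier) → Carrier → Carrier → Set
  SamePoint g₁ g₂ x y = Σ Carrier λ λ' → (λ' ≢ 0#)
                        × (g₁ y ≡ λ' * g₁ x) × (g₂ y ≡ λ' * g₂ x)

  -- L_{g₁,g₂} is proper: it contains more than one point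
  IsProper : (g₁ g₂ : Carrier → Carrier) → Set
  IsProper g₁ g₂ = Σ Carrier λ x → Σ Carrier λ y →
                   (x ≢ 0#) × (y ≢ 0#) × ¬ SamePoint g₁ g₂ x y

  cardU : (g₁ g₂ : Carrier → Carrier) → ℕ
  cardU g₁ g₂ = length (deduplicate (PP.≡-dec _≟_ _≟_)
                          (map (λ x → (g₁ x , g₂ x)) elements))

  -- L_{g₁,g₂} has rank r, i.e. dim_{F_q} U = r, i.e. |U| = q^r
  HasRankLS : (q r : ℕ) (g₁ g₂ : Carrier → Carrier) → Set
  HasRankLS q r g₁ g₂ = cardU g₁ g₂ ≡ q ^ r

  elementsC : (f₁ f₂ : Carrier → Carrier) → List (List Carrier)
  elementsC f₁ f₂ = deduplicate (LP.≡-dec _≟_)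
    (concatMap (λ a → map (λ b → table (lin a f₁ b f₂)) elements) elements)

  -- A_i: number of elements of C of rank i (rank over F_q = dim of the
  -- image, i.e. |image| = q^i; the image is the set of table entries)
  A : (q : ℕ) (f₁ f₂ : Carrier → Carrier) → ℕ → ℕ
  A q f₁ f₂ i = length (filter (λ t → card t ℕ.≟ q ^ i) (elementsC f₁ f₂))

-- Gaussian binomial [m 1]_q = (q^m - 1)/(q - 1) = 1 + q + ... + q^(m-1)
gauss1 : ℕ → ℕ → ℕ
gauss1 zero    q = 0
gauss1 (suc m) q = q ^ m ℕ.+ gauss1 m q

sumBelow : ℕ → (ℕ → ℕ) → ℕ
sumBelow zero    f = 0
sumBelow (suc k) f = sumBelow k f ℕ.+ f k

-- Double counting.  Write the elements of C as h a b = a f₁ + b f₂; since g₁, g₂ is a basis of C,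
-- f₁ and f₂ are independent as well, so the |K|² pairs (a, b) give distinct elements.  Count the
-- pairs ((a, b), x) with h a b x = 0.  As L has rank n, x ↦ (g₁ x, g₂ x) is injective, so
-- f₁ x = f₂ x = 0 only for x = 0: hence 0 lies in every kernel and each x ≠ 0 in exactly |K| of them.
-- On the other hand every F-subspace of K has q ^ k elements, so by rank–nullity the kernel of
-- h a b has q ^ (n - rank) elements.  Writing q ^ m = (q - 1) [m]_q + 1, the two counts give
-- Σᵢ Aᵢ [n - i]_q = q ^ n [n]_q, whose terms i = n - 1 and i = n are A_{n-1} and 0.

module Submission where

open import Defs hiding (A)
open import Data.Nat using (ℕ; _^_)
open import Data.List using (List)
open import Data.List.Membership.Propositional using (_∈_)
open import Data.List.Relation.Unary.Unique.Propositional using (Unique)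
open import Relation.Binary.Definitions using (DecidableEquality)
open import Relation.Binary.PropositionalEquality using (_≡_)

module ListCounting where

  open import Data.Nat using (zero; suc; _+_; _*_; _∸_; _≤_; _<_; _≟_; s≤s; z≤n)
  open import Data.Nat.Properties
    using (+-assoc; +-comm; +-identityʳ; *-zeroʳ; *-distribʳ-+; *-distribˡ-+;
           ≤-refl; <-irrefl; ≤∧≢⇒<; ≤-pred; <⇒≤; suc-injective; ≤-antisym; +-commutativeSemigroup)
  open import Algebra.Properties.CommutativeSemigroup +-commutativeSemigroup using (interchange)
  open import Data.List using ([]; _∷_; [_]; length; filter; map; concatMap; _++_; deduplicate; cartesianProductWith)
  open import Data.List.Properties
    using (filter-none; filter-all; filter-complete; length-filter; length-deduplicate; ∷-injective)
  open import Data.List.Membership.Propositional.Properties using (∈-filter⁺; ∈-filter⁻; ∈-map⁺; ∈-deduplicate⁺)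
  open import Data.List.Membership.Propositional.Properties.WithK using (unique∧set⇒bag)
  open import Data.List.Relation.Binary.BagAndSetEquality using (∼bag⇒↭)
  open import Data.List.Relation.Binary.Permutation.Propositional.Properties using (↭-length)
  open import Data.List.Relation.Unary.All as All using (All; []; _∷_)
  open import Data.List.Relation.Unary.All.Properties using (all-filter)
  open import Data.List.Relation.Unary.Any using (here; there)
  open import Data.List.Relation.Unary.AllPairs using ([]; _∷_)
  open import Data.List.Relation.Unary.Unique.Propositional.Properties using (filter⁺)
  open import Data.Product using (proj₁; proj₂)
  open import Data.Empty using (⊥-elim)
  open import Function.Bundles using (mk⇔)
  open import Relation.Nullary using (¬_; ¬?; Dec; yes; no)
  open import Relation.Unary using (Decidable)
  open import Relation.Binary.PropositionalEquality
    using (_≢_; refl; sym; trans; cong; cong₂; subst; ≢-sym; module ≡-Reasoning)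
  open ≡-Reasoning

  private variable
    A B : Set

  χ : {P : Set} → Dec P → ℕ
  χ (yes _) = 1
  χ (no _)  = 0

  χ-cong : {P Q : Set} (p? : Dec P) (q? : Dec Q) → (P → Q) → (Q → P) → χ p? ≡ χ q?
  χ-cong (yes _) (yes _) _   _   = refl
  χ-cong (yes p) (no ¬q) p→q _   = ⊥-elim (¬q (p→q p))
  χ-cong (no ¬p) (yes q) _   q→p = ⊥-elim (¬p (q→p q))
  χ-cong (no _)  (no _)  _   _   = refl

  ∑ : List A → (A → ℕ) → ℕ
  ∑ []       f = 0
  ∑ (x ∷ xs) f = f x + ∑ xs f

  syntax ∑ xs (λ x → e) = ∑[ x ∈ xs ] e

  ∑-cong : ∀ (xs : List A) {f g : A → ℕ} → (∀ x → f x ≡ g x) → ∑ xs f ≡ ∑ xs g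
  ∑-cong []       f≗g = refl
  ∑-cong (x ∷ xs) f≗g = cong₂ _+_ (f≗g x) (∑-cong xs f≗g)

  ∑-const : ∀ (xs : List A) (c : ℕ) → ∑[ x ∈ xs ] c ≡ length xs * c
  ∑-const []       c = refl
  ∑-const (x ∷ xs) c = cong (c +_) (∑-const xs c)

  ∑-constOn : ∀ {xs : List A} {f : A → ℕ} {c} → All (λ x → f x ≡ c) xs → ∑ xs f ≡ length xs * c
  ∑-constOn []             = refl
  ∑-constOn (fx≡c ∷ f≡c) = cong₂ _+_ fx≡c (∑-constOn f≡c)

  ∑-distrib-+ : ∀ (xs : List A) (f g : A → ℕ) → ∑[ x ∈ xs ] (f x + g x) ≡ ∑ xs f + ∑ xs g
  ∑-distrib-+ []       f g = refl
  ∑-distrib-+ (x ∷ xs) f g =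
    trans (cong (f x + g x +_) (∑-distrib-+ xs f g)) (interchange (f x) (g x) (∑ xs f) (∑ xs g))

  ∑-distribʳ-* : ∀ (xs : List A) (f : A → ℕ) (c : ℕ) → ∑[ x ∈ xs ] (f x * c) ≡ ∑ xs f * c
  ∑-distribʳ-* []       f c = refl
  ∑-distribʳ-* (x ∷ xs) f c =
    trans (cong (f x * c +_) (∑-distribʳ-* xs f c)) (sym (*-distribʳ-+ c (f x) (∑ xs f)))

  ∑-comm : ∀ (xs : List A) (ys : List B) (f : A → B → ℕ) →
           ∑[ x ∈ xs ] ∑[ y ∈ ys ] f x y ≡ ∑[ y ∈ ys ] ∑[ x ∈ xs ] f x y
  ∑-comm []       ys f = sym (trans (∑-const ys 0) (*-zeroʳ (length ys)))
  ∑-comm (x ∷ xs) ys f =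
    trans (cong (∑ ys (f x) +_) (∑-comm xs ys f)) (sym (∑-distrib-+ ys (f x) _))

  ∑-distribˡ-* : ∀ (xs : List A) (f : A → ℕ) (c : ℕ) → ∑[ x ∈ xs ] (c * f x) ≡ c * ∑ xs f
  ∑-distribˡ-* []       f c = sym (*-zeroʳ c)
  ∑-distribˡ-* (x ∷ xs) f c =
    trans (cong (c * f x +_) (∑-distribˡ-* xs f c)) (sym (*-distribˡ-+ c (f x) (∑ xs f)))

  ∑-constExcept : ∀ {xs : List A} {a} (f : A → ℕ) {c} → Unique xs → a ∈ xs →
                  (∀ x → x ≢ a → f x ≡ c) → ∑ xs f + c ≡ length xs * c + f a
  ∑-constExcept {xs = a ∷ xs} {a} f {c} (a∉xs ∷ _) (here refl) f≡c = begin
    f a + ∑ xs f + c          ≡⟨ cong (λ s → f a + s + c) (∑-constOn (All.map (λ a≢x → f≡c _ (≢-sym a≢x)) a∉xs)) ⟩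
    f a + length xs * c + c   ≡⟨ +-comm (f a + length xs * c) c ⟩
    c + (f a + length xs * c) ≡⟨ cong (c +_) (+-comm (f a) (length xs * c)) ⟩
    c + (length xs * c + f a) ≡⟨ sym (+-assoc c (length xs * c) (f a)) ⟩
    c + length xs * c + f a   ∎
  ∑-constExcept {xs = y ∷ xs} {a} f {c} (y∉xs ∷ xs!) (there a∈xs) f≡c = begin
    f y + ∑ xs f + c           ≡⟨ cong (λ t → t + ∑ xs f + c) (f≡c y (λ { refl → All.lookup y∉xs a∈xs refl })) ⟩
    c + ∑ xs f + c             ≡⟨ +-assoc c (∑ xs f) c ⟩
    c + (∑ xs f + c)           ≡⟨ cong (c +_) (∑-constExcept f xs! a∈xs f≡c) ⟩
    c + (length xs * c + f a)  ≡⟨ sym (+-assoc c (length xs * c) (f a)) ⟩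
    c + length xs * c + f a    ∎

  count : {P : A → Set} → Decidable P → List A → ℕ
  count P? xs = length (filter P? xs)

  count-∷ : {P : A → Set} (P? : Decidable P) (x : A) (xs : List A) →
            count P? (x ∷ xs) ≡ χ (P? x) + count P? xs
  count-∷ P? x xs with P? x
  ... | yes _ = refl
  ... | no  _ = refl

  count≡∑χ : {P : A → Set} (P? : Decidable P) (xs : List A) → count P? xs ≡ ∑[ x ∈ xs ] χ (P? x)
  count≡∑χ P? []       = refl
  count≡∑χ P? (x ∷ xs) = trans (count-∷ P? x xs) (cong (χ (P? x) +_) (count≡∑χ P? xs))

  ∑χ*≡count* : {P : A → Set} (P? : Decidable P) (xs : List A) (c : ℕ) →
          ∑[ x ∈ xs ] (χ (P? x) * c) ≡ count P? xs * c
  ∑χ*≡count* P? xs c = trans (∑-distribʳ-* xs (λ x → χ (P? x)) c) (cong (_* c) (sym (count≡∑χ P? xs)))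

  ∑-count-comm : ∀ {R : A → B → Set} (R? : ∀ x → Decidable (R x)) (xs : List A) (ys : List B) →
                 ∑[ x ∈ xs ] count (R? x) ys ≡ ∑[ y ∈ ys ] count (λ x → R? x y) xs
  ∑-count-comm R? xs ys = begin
    ∑[ x ∈ xs ] count (R? x) ys                 ≡⟨ ∑-cong xs (λ x → count≡∑χ (R? x) ys) ⟩
    ∑[ x ∈ xs ] ∑[ y ∈ ys ] χ (R? x y)          ≡⟨ ∑-comm xs ys _ ⟩
    ∑[ y ∈ ys ] ∑[ x ∈ xs ] χ (R? x y)          ≡⟨ ∑-cong ys (λ y → sym (count≡∑χ (λ x → R? x y) xs)) ⟩
    ∑[ y ∈ ys ] count (λ x → R? x y) xs         ∎

  count-cong : {P Q : A → Set} (P? : Decidable P) (Q? : Decidable Q) (xs : List A) →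
               (∀ x → P x → Q x) → (∀ x → Q x → P x) → count P? xs ≡ count Q? xs
  count-cong P? Q? xs P⇒Q Q⇒P = begin
    count P? xs            ≡⟨ count≡∑χ P? xs ⟩
    ∑[ x ∈ xs ] χ (P? x)   ≡⟨ ∑-cong xs (λ x → χ-cong (P? x) (Q? x) (P⇒Q x) (Q⇒P x)) ⟩
    ∑[ x ∈ xs ] χ (Q? x)   ≡⟨ sym (count≡∑χ Q? xs) ⟩
    count Q? xs            ∎

  count-none : {P : A → Set} (P? : Decidable P) (xs : List A) → (∀ x → ¬ P x) → count P? xs ≡ 0
  count-none P? xs ¬P = cong length (filter-none P? {xs} (All.tabulate (λ {x} _ → ¬P x)))

  count-all : {P : A → Set} (P? : Decidable P) (xs : List A) → (∀ x → P x) → count P? xs ≡ length xs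
  count-all P? xs allP = cong length (filter-all P? {xs} (All.tabulate (λ {x} _ → allP x)))

  length-sameMembers : {xs ys : List A} → Unique xs → Unique ys →
                       (∀ {z} → z ∈ xs → z ∈ ys) → (∀ {z} → z ∈ ys → z ∈ xs) → length xs ≡ length ys
  length-sameMembers xs! ys! xs⊆ys ys⊆xs =
    ↭-length (∼bag⇒↭ (unique∧set⇒bag xs! ys! (mk⇔ xs⊆ys ys⊆xs)))

  count-uniqueWitness : {P : A → Set} (P? : Decidable P) {xs : List A} {a : A} →
                        Unique xs → a ∈ xs → P a → (∀ {x} → P x → x ≡ a) → count P? xs ≡ 1
  count-uniqueWitness P? {xs} {a} xs! a∈xs Pa P⇒≡a =
    length-sameMembers {ys = [ a ]} (filter⁺ P? xs!) ([] ∷ [])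
      (λ z∈ → here (P⇒≡a (proj₂ (∈-filter⁻ P? {xs = xs} z∈))))
      (λ { (here refl) → ∈-filter⁺ P? a∈xs Pa })

  ∑-++ : ∀ (xs ys : List A) (f : A → ℕ) → ∑ (xs ++ ys) f ≡ ∑ xs f + ∑ ys f
  ∑-++ []       ys f = refl
  ∑-++ (x ∷ xs) ys f = trans (cong (f x +_) (∑-++ xs ys f)) (sym (+-assoc (f x) (∑ xs f) (∑ ys f)))

  ∑-map : ∀ (g : A → B) (xs : List A) (f : B → ℕ) → ∑ (map g xs) f ≡ ∑[ x ∈ xs ] f (g x)
  ∑-map g []       f = refl
  ∑-map g (x ∷ xs) f = cong (f (g x) +_) (∑-map g xs f)

  ∑-concatMap : ∀ (g : A → List B) (xs : List A) (f : B → ℕ) →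
                ∑ (concatMap g xs) f ≡ ∑[ x ∈ xs ] ∑ (g x) f
  ∑-concatMap g []       f = refl
  ∑-concatMap g (x ∷ xs) f = trans (∑-++ (g x) (concatMap g xs) f) (cong (∑ (g x) f +_) (∑-concatMap g xs f))

  concatMap-map≡cartesianProductWith : ∀ {C : Set} (g : A → B → C) (xs : List A) (ys : List B) →
    concatMap (λ x → map (g x) ys) xs ≡ cartesianProductWith g xs ys
  concatMap-map≡cartesianProductWith g []       ys = refl
  concatMap-map≡cartesianProductWith g (x ∷ xs) ys =
    cong (map (g x) ys ++_) (concatMap-map≡cartesianProductWith g xs ys)

  module _ (_≟_ : DecidableEquality A) where

    Unique⇒deduplicate≡id : ∀ {xs : List A} → Unique xs → deduplicate _≟_ xs ≡ xs
    Unique⇒deduplicate≡id {[]}     []          = refl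
    Unique⇒deduplicate≡id {x ∷ xs} (x∉xs ∷ xs!) =
      cong (x ∷_) (trans (cong (filter (λ y → ¬? (x ≟ y))) (Unique⇒deduplicate≡id xs!))
                         (filter-all (λ y → ¬? (x ≟ y)) x∉xs))

    length-deduplicate≡⇒Unique : ∀ (xs : List A) → length (deduplicate _≟_ xs) ≡ length xs → Unique xs
    length-deduplicate≡⇒Unique []       _  = []
    length-deduplicate≡⇒Unique (x ∷ xs) eq =
      All.tabulate (λ y∈xs → All.lookup x∉ded (∈-deduplicate⁺ _≟_ y∈xs)) ∷ length-deduplicate≡⇒Unique xs ded≡xs
      where
      ded  = deduplicate _≟_ xs
      kept = filter (λ y → ¬? (x ≟ y)) ded
      kept≡xs : length kept ≡ length xs
      kept≡xs = suc-injective eq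
      ded≡xs : length ded ≡ length xs
      ded≡xs = ≤-antisym (length-deduplicate _≟_ xs) (subst (_≤ length ded) kept≡xs (length-filter _ ded))
      x∉ded : All (x ≢_) ded
      x∉ded = subst (All (x ≢_)) (filter-complete _ (trans kept≡xs (sym ded≡xs))) (all-filter _ ded)

  Unique-map⇒injectiveOn : ∀ (f : A → B) {xs : List A} → Unique (map f xs) →
                           ∀ {x y} → x ∈ xs → y ∈ xs → f x ≡ f y → x ≡ y
  Unique-map⇒injectiveOn f _          (here refl) (here refl) _     = refl
  Unique-map⇒injectiveOn f (fx∉ ∷ _)  (here refl) (there y∈)  fx≡fy = ⊥-elim (All.lookup fx∉ (∈-map⁺ f y∈) fx≡fy)
  Unique-map⇒injectiveOn f (fy∉ ∷ _)  (there x∈)  (here refl) fx≡fy = ⊥-elim (All.lookup fy∉ (∈-map⁺ f x∈) (sym fx≡fy))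
  Unique-map⇒injectiveOn f (_ ∷ fxs!) (there x∈)  (there y∈)  fx≡fy = Unique-map⇒injectiveOn f fxs! x∈ y∈ fx≡fy

  distinct∈⇒1<length : ∀ {x y : A} {xs} → x ≢ y → x ∈ xs → y ∈ xs → 1 < length xs
  distinct∈⇒1<length {xs = _ ∷ _ ∷ _} _   _           _           = s≤s (s≤s z≤n)
  distinct∈⇒1<length {xs = _ ∷ []}    x≢y (here refl) (here refl) = ⊥-elim (x≢y refl)
  distinct∈⇒1<length {xs = _ ∷ []}    _   (here _)    (there ())
  distinct∈⇒1<length {xs = _ ∷ []}    _   (there ())  _

  map≡map⇒pointwise : ∀ (f g : A → B) {xs : List A} → map f xs ≡ map g xs → ∀ {x} → x ∈ xs → f x ≡ g x
  map≡map⇒pointwise f g {_ ∷ _}  fxs≡gxs (here refl) = proj₁ (∷-injective fxs≡gxs)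
  map≡map⇒pointwise f g {_ ∷ xs} fxs≡gxs (there x∈)  = map≡map⇒pointwise f g (proj₂ (∷-injective fxs≡gxs)) x∈

  sumBelow-cong : ∀ N {f g : ℕ → ℕ} → (∀ i → f i ≡ g i) → sumBelow N f ≡ sumBelow N g
  sumBelow-cong zero    f≗g = refl
  sumBelow-cong (suc N) f≗g = cong₂ _+_ (sumBelow-cong N f≗g) (f≗g N)

  ∑-sumBelow-comm : ∀ (xs : List A) N (f : A → ℕ → ℕ) →
                    ∑[ x ∈ xs ] sumBelow N (f x) ≡ sumBelow N (λ i → ∑[ x ∈ xs ] f x i)
  ∑-sumBelow-comm xs zero    f = trans (∑-const xs 0) (*-zeroʳ (length xs))
  ∑-sumBelow-comm xs (suc N) f =
    trans (∑-distrib-+ xs (λ x → sumBelow N (f x)) (λ x → f x N)) (cong (_+ ∑[ x ∈ xs ] f x N) (∑-sumBelow-comm xs N f))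

  sumBelow-indicator-≥ : ∀ N r (g : ℕ → ℕ) → N ≤ r → sumBelow N (λ i → χ (r ≟ i) * g i) ≡ 0
  sumBelow-indicator-≥ zero    r g _   = refl
  sumBelow-indicator-≥ (suc N) r g N<r with r ≟ N
  ... | yes refl = ⊥-elim (<-irrefl refl N<r)
  ... | no  _    = trans (+-identityʳ _) (sumBelow-indicator-≥ N r g (<⇒≤ N<r))

  sumBelow-indicator : ∀ N r (g : ℕ → ℕ) → r < N → sumBelow N (λ i → χ (r ≟ i) * g i) ≡ g r
  sumBelow-indicator (suc N) r g r<1+N with r ≟ N
  ... | yes refl = trans (cong (_+ (g r + 0)) (sumBelow-indicator-≥ N r g ≤-refl)) (+-identityʳ (g r))
  ... | no  r≢N  = trans (+-identityʳ _) (sumBelow-indicator N r g (≤∧≢⇒< (≤-pred r<1+N) r≢N))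

  ∑-groupBy : ∀ (xs : List A) N (r : A → ℕ) (g : ℕ → ℕ) → (∀ x → r x < N) →
              ∑[ x ∈ xs ] g (r x) ≡ sumBelow N (λ i → (∑[ x ∈ xs ] χ (r x ≟ i)) * g i)
  ∑-groupBy xs N r g r<N = begin
    ∑[ x ∈ xs ] g (r x)                                    ≡⟨ ∑-cong xs (λ x → sym (sumBelow-indicator N (r x) g (r<N x))) ⟩
    ∑[ x ∈ xs ] sumBelow N (λ i → χ (r x ≟ i) * g i)       ≡⟨ ∑-sumBelow-comm xs N _ ⟩
    sumBelow N (λ i → ∑[ x ∈ xs ] (χ (r x ≟ i) * g i))     ≡⟨ sumBelow-cong N (λ i → ∑-distribʳ-* xs _ (g i)) ⟩
    sumBelow N (λ i → (∑[ x ∈ xs ] χ (r x ≟ i)) * g i)       ∎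

  pow≡*gauss1+1 : ∀ {q} m → 1 ≤ q → q ^ m ≡ (q ∸ 1) * gauss1 m q + 1
  pow≡*gauss1+1 {suc p} zero    _   = cong (_+ 1) (sym (*-zeroʳ p))
  pow≡*gauss1+1 {suc p} (suc m) 1≤q = begin
    suc p * Q             ≡⟨ +-comm Q (p * Q) ⟩
    p * Q + Q             ≡⟨ cong (p * Q +_) (pow≡*gauss1+1 m 1≤q) ⟩
    p * Q + (p * G + 1)   ≡⟨ sym (+-assoc (p * Q) (p * G) 1) ⟩
    p * Q + p * G + 1     ≡⟨ cong (_+ 1) (sym (*-distribˡ-+ p Q G)) ⟩
    p * (Q + G) + 1       ∎
    where
    Q = suc p ^ m
    G = gauss1 m (suc p)

module Enumerations {A : Set} (_≟_ : DecidableEquality A) (xs : List A)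
                    (complete : ∀ x → x ∈ xs) (unique : Unique xs) where

  open import Data.Nat using (suc; _+_)
  open import Data.Nat.Properties using (*-zeroʳ)
  open import Data.List using ([]; _∷_; length; filter; map)
  open import Data.List.Properties using (length-map)
  open import Data.List.Membership.Propositional.Properties using (∈-filter⁺; ∈-filter⁻; ∈-map⁺; ∈-map⁻)
  open import Data.List.Relation.Unary.Unique.Propositional.Properties using (filter⁺; map⁺)
  open import Data.Product using (_,_; proj₂)
  open import Relation.Unary using (Decidable)
  open import Relation.Binary.PropositionalEquality using (refl; sym; trans; cong; cong₂; subst; module ≡-Reasoning)
  open ≡-Reasoning
  open ListCounting

  count-exactlyOne : {P : A → Set} (P? : Decidable P) {a : A} → P a → (∀ {x} → P x → x ≡ a) →
                     count P? xs ≡ 1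
  count-exactlyOne P? Pa P⇒≡a = count-uniqueWitness P? unique (complete _) Pa P⇒≡a

  length≡∑fibres : {B : Set} (φ : B → A) (ys : List B) →
                   length ys ≡ ∑[ a ∈ xs ] count (λ y → φ y ≟ a) ys
  length≡∑fibres φ []       = sym (trans (∑-const xs 0) (*-zeroʳ (length xs)))
  length≡∑fibres φ (y ∷ ys) = begin
    suc (length ys)
      ≡⟨ cong₂ _+_ (sym (count-exactlyOne (φ y ≟_) refl sym)) (length≡∑fibres φ ys) ⟩
    count (φ y ≟_) xs + ∑[ a ∈ xs ] count (λ y → φ y ≟ a) ys
      ≡⟨ cong (_+ ∑[ a ∈ xs ] count (λ y → φ y ≟ a) ys) (count≡∑χ (φ y ≟_) xs) ⟩
    ∑[ a ∈ xs ] χ (φ y ≟ a) + ∑[ a ∈ xs ] count (λ y → φ y ≟ a) ys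
      ≡⟨ sym (∑-distrib-+ xs _ _) ⟩
    ∑[ a ∈ xs ] (χ (φ y ≟ a) + count (λ y → φ y ≟ a) ys)
      ≡⟨ ∑-cong xs (λ a → sym (count-∷ (λ y → φ y ≟ a) y ys)) ⟩
    ∑[ a ∈ xs ] count (λ y → φ y ≟ a) (y ∷ ys) ∎

  count-reindex : {P : A → Set} (P? : Decidable P) (σ τ : A → A) →
                  (∀ x → τ (σ x) ≡ x) → (∀ y → σ (τ y) ≡ y) →
                  count (λ x → P? (σ x)) xs ≡ count P? xs
  count-reindex {P} P? σ τ τσ≗id στ≗id = begin
    length (filter P?∘σ xs)          ≡⟨ sym (length-map σ (filter P?∘σ xs)) ⟩
    length (map σ (filter P?∘σ xs))  ≡⟨ length-sameMembers (map⁺ σ-injective (filter⁺ P?∘σ unique))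
                                                            (filter⁺ P? unique) image⊆ ⊆image ⟩
    length (filter P? xs)            ∎
    where
    P?∘σ : Decidable (λ x → P (σ x))
    P?∘σ x = P? (σ x)
    σ-injective : ∀ {x y} → σ x ≡ σ y → x ≡ y
    σ-injective {x} {y} σx≡σy = trans (sym (τσ≗id x)) (trans (cong τ σx≡σy) (τσ≗id y))
    image⊆ : ∀ {z} → z ∈ map σ (filter P?∘σ xs) → z ∈ filter P? xs
    image⊆ z∈ with ∈-map⁻ σ z∈
    ... | x , x∈ , refl = ∈-filter⁺ P? (complete (σ x)) (proj₂ (∈-filter⁻ P?∘σ {xs = xs} x∈))
    ⊆image : ∀ {z} → z ∈ filter P? xs → z ∈ map σ (filter P?∘σ xs)
    ⊆image {z} z∈ = subst (_∈ map σ (filter P?∘σ xs)) (στ≗id z)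
      (∈-map⁺ σ (∈-filter⁺ P?∘σ (complete (τ z))
                   (subst P (sym (στ≗id z)) (proj₂ (∈-filter⁻ P? {xs = xs} z∈)))))

module FieldLinearAlgebra (K : FiniteField) where

  open import Level using (0ℓ)
  open import Data.Nat as ℕ using (zero; suc; _∸_; _≤_; _<_)
  import Data.Nat.Properties as ℕ
  open import Data.List using (length)
  open import Data.List.Properties using (length-filter)
  open import Data.List.Membership.Propositional using (lose)
  open import Data.List.Membership.Propositional.Properties
    using (∈-map⁺; ∈-map⁻; ∈-filter⁺; ∈-filter⁻; ∈-deduplicate⁺; ∈-deduplicate⁻)
  open import Data.List.Relation.Unary.Any using (Any; any?; satisfied)
  open import Data.List.Relation.Unary.Unique.Propositional.Properties using (filter⁺)
  open import Data.Product using (∃-syntax; _×_; _,_; proj₁; proj₂)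
  open import Data.Empty using (⊥-elim)
  open import Relation.Nullary using (¬_; yes; no; ¬?)
  open import Relation.Nullary.Decidable using (_×-dec_)
  open import Relation.Unary using (Decidable)
  open import Relation.Binary.Definitions using (tri<; tri≈; tri>)
  open import Relation.Binary.PropositionalEquality
    using (_≢_; refl; sym; trans; cong; cong₂; subst; subst₂; module ≡-Reasoning)
  open import Algebra.Bundles using (CommutativeRing)
  open ≡-Reasoning
  open ListCounting
  open FiniteField K
  open Enumerations _≟_ elements complete unique
  open import Data.List.Membership.DecPropositional _≟_ using (_∈?_)
  open import Data.List.Relation.Unary.Unique.DecPropositional.Properties _≟_ using (deduplicate-!)

  commutativeRing : CommutativeRing 0ℓ 0ℓ
  commutativeRing = record { isCommutativeRing = isCommutativeRing }

  open CommutativeRing commutativeRing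
    using (+-assoc; +-identityˡ; +-identityʳ; -‿inverseˡ; -‿inverseʳ; *-assoc; *-comm;
           *-identityˡ; *-identityʳ; distribʳ; zeroˡ; zeroʳ; ring; commutativeSemiring)
  open import Algebra.Properties.Ring ring
    using (+-cancelˡ; +-cancelʳ; +-identityˡ-unique; -‿distribˡ-*; -‿+-comm; x∙y⁻¹≈ε⇒x≈y; -1*x≈-x)
  open import Algebra.Solver.Ring.NaturalCoefficients.Default commutativeSemiring using (solve; _:+_; _:*_; _:=_; con)

  x+t-t≡x : ∀ x t → x + t + - t ≡ x
  x+t-t≡x x t = trans (+-assoc x t (- t)) (trans (cong (x +_) (-‿inverseʳ t)) (+-identityʳ x))

  x-t+t≡x : ∀ x t → x + - t + t ≡ x
  x-t+t≡x x t = trans (+-assoc x (- t) t) (trans (cong (x +_) (-‿inverseˡ t)) (+-identityʳ x))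

  count-translate : {P : Carrier → Set} (P? : Decidable P) (t : Carrier) →
                    count (λ x → P? (x + t)) elements ≡ count P? elements
  count-translate P? t = count-reindex P? (_+ t) (_+ - t) (λ x → x+t-t≡x x t) (λ y → x-t+t≡x y t)

  card≡count-∈ : ∀ l → card K l ≡ count (_∈? l) elements
  card≡count-∈ l = length-sameMembers (deduplicate-! l) (filter⁺ (_∈? l) unique)
    (λ z∈ → ∈-filter⁺ (_∈? l) (complete _) (∈-deduplicate⁻ _≟_ l z∈))
    (λ z∈ → ∈-deduplicate⁺ _≟_ (proj₂ (∈-filter⁻ (_∈? l) {xs = elements} z∈)))

  1<size : 1 < size
  1<size = distinct∈⇒1<length 0≢1 (complete 0#) (complete 1#)

  count-affineRoots : ∀ s {v} → v ≢ 0# → count (λ b → (s + b * v) ≟ 0#) elements ≡ 1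
  count-affineRoots s {v} v≢0 with inverse v v≢0
  ... | e , ve≡1 = count-exactlyOne (λ b → (s + b * v) ≟ 0#) root-is-root root-unique
    where
    root = - s * e
    cancel-v : ∀ {b b′} → b * v ≡ b′ * v → b ≡ b′
    cancel-v {b} {b′} bv≡b′v = begin
      b              ≡⟨ sym (trans (cong (b *_) ve≡1) (*-identityʳ b)) ⟩
      b * (v * e)    ≡⟨ sym (*-assoc b v e) ⟩
      (b * v) * e    ≡⟨ cong (_* e) bv≡b′v ⟩
      (b′ * v) * e   ≡⟨ *-assoc b′ v e ⟩
      b′ * (v * e)   ≡⟨ trans (cong (b′ *_) ve≡1) (*-identityʳ b′) ⟩
      b′             ∎
    root-is-root : s + root * v ≡ 0#
    root-is-root = begin
      s + (- s * e) * v  ≡⟨ cong (s +_) (trans (*-assoc (- s) e v) (cong (- s *_) (trans (*-comm e v) ve≡1))) ⟩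
      s + - s * 1#       ≡⟨ cong (s +_) (*-identityʳ (- s)) ⟩
      s + - s            ≡⟨ -‿inverseʳ s ⟩
      0#                 ∎
    root-unique : ∀ {b} → s + b * v ≡ 0# → b ≡ root
    root-unique s+bv≡0 = cancel-v (+-cancelˡ s _ _ (trans s+bv≡0 (sym root-is-root)))

  lin-vanishes : ∀ a b {p₁ p₂ : Carrier → Carrier} {y} → p₁ y ≡ 0# → p₂ y ≡ 0# → lin K a p₁ b p₂ y ≡ 0#
  lin-vanishes a b p₁y≡0 p₂y≡0 =
    trans (cong₂ (λ s t → a * s + b * t) p₁y≡0 p₂y≡0) (trans (cong₂ _+_ (zeroʳ a) (zeroʳ b)) (+-identityˡ 0#))

  Independent : (Carrier → Carrier) → (Carrier → Carrier) → Set
  Independent p₁ p₂ = ∀ a b → (∀ x → lin K a p₁ b p₂ x ≡ 0#) → a ≡ 0# × b ≡ 0#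

  lin-difference : ∀ a b a′ b′ (p₁ p₂ : Carrier → Carrier) x →
                   lin K a p₁ b p₂ x + - lin K a′ p₁ b′ p₂ x ≡ lin K (a + - a′) p₁ (b + - b′) p₂ x
  lin-difference a b a′ b′ p₁ p₂ x = begin
    (a * u + b * v) + - (a′ * u + b′ * v)      ≡⟨ cong ((a * u + b * v) +_) (sym (-‿+-comm (a′ * u) (b′ * v))) ⟩
    (a * u + b * v) + (- (a′ * u) + - (b′ * v)) ≡⟨ cong ((a * u + b * v) +_)
                                                       (cong₂ _+_ (-‿distribˡ-* a′ u) (-‿distribˡ-* b′ v)) ⟩
    (a * u + b * v) + (- a′ * u + - b′ * v)    ≡⟨ solve 6 (λ a b na nb u v → (a :* u :+ b :* v) :+ (na :* u :+ nb :* v)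
                                                              := (a :+ na) :* u :+ (b :+ nb) :* v) refl a b (- a′) (- b′) u v ⟩
    (a + - a′) * u + (b + - b′) * v            ∎
    where
    u = p₁ x
    v = p₂ x

  Independent⇒lin-injective : ∀ {p₁ p₂} → Independent p₁ p₂ → ∀ {a b a′ b′} →
                              (∀ x → lin K a p₁ b p₂ x ≡ lin K a′ p₁ b′ p₂ x) → a ≡ a′ × b ≡ b′
  Independent⇒lin-injective {p₁} {p₂} independent {a} {b} {a′} {b′} same
    with independent (a + - a′) (b + - b′)
           (λ x → trans (sym (lin-difference a b a′ b′ p₁ p₂ x))
                        (trans (cong (_+ - lin K a′ p₁ b′ p₂ x) (same x)) (-‿inverseʳ _)))
  ... | a-a′≡0 , b-b′≡0 = x∙y⁻¹≈ε⇒x≈y a a′ a-a′≡0 , x∙y⁻¹≈ε⇒x≈y b b′ b-b′≡0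

  -- In matrix terms: (a b) N = 0 for N = (c d; c′ d′) gives a · det N = b · det N = 0.
  rowKernel⇒annihilates-det : ∀ {c d c′ d′ a b} → a * c + b * c′ ≡ 0# → a * d + b * d′ ≡ 0# →
                              a * (c * d′) ≡ a * (d * c′) × b * (c * d′) ≡ b * (d * c′)
  rowKernel⇒annihilates-det {c} {d} {c′} {d′} {a} {b} v₁ v₂ =
    +-cancelʳ (b * (c′ * d′)) _ _ (begin
      a * (c * d′) + b * (c′ * d′)  ≡⟨ solve 5 (λ a b c c′ d′ → a :* (c :* d′) :+ b :* (c′ :* d′)
                                                            := (a :* c :+ b :* c′) :* d′) refl a b c c′ d′ ⟩
      (a * c + b * c′) * d′         ≡⟨ trans (cong (_* d′) v₁) (zeroˡ d′) ⟩
      0#                            ≡⟨ sym (trans (cong (_* c′) v₂) (zeroˡ c′)) ⟩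
      (a * d + b * d′) * c′         ≡⟨ solve 5 (λ a b d c′ d′ → (a :* d :+ b :* d′) :* c′
                                                            := a :* (d :* c′) :+ b :* (c′ :* d′)) refl a b d c′ d′ ⟩
      a * (d * c′) + b * (c′ * d′)  ∎) ,
    +-cancelʳ (a * (c * d)) _ _ (begin
      b * (c * d′) + a * (c * d)    ≡⟨ solve 5 (λ a b c d d′ → b :* (c :* d′) :+ a :* (c :* d)
                                                            := (a :* d :+ b :* d′) :* c) refl a b c d d′ ⟩
      (a * d + b * d′) * c          ≡⟨ trans (cong (_* c) v₂) (zeroˡ c) ⟩
      0#                            ≡⟨ sym (trans (cong (_* d) v₁) (zeroˡ d)) ⟩
      (a * c + b * c′) * d          ≡⟨ solve 5 (λ a b c d c′ → (a :* c :+ b :* c′) :* d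
                                                            := b :* (d :* c′) :+ a :* (c :* d)) refl a b c d c′ ⟩
      b * (d * c′) + a * (c * d)    ∎)

  -- M N = 1 for M = (α β; γ δ) gives det M · det N = 1, so nothing but 0 annihilates det N.  The
  -- determinants are kept subtraction-free: det M · det N = U - V.
  rowKernel-trivial : ∀ {α β γ δ c d c′ d′ a b} →
    α * c + β * c′ ≡ 1# → α * d + β * d′ ≡ 0# → γ * c + δ * c′ ≡ 0# → γ * d + δ * d′ ≡ 1# →
    a * c + b * c′ ≡ 0# → a * d + b * d′ ≡ 0# → a ≡ 0# × b ≡ 0#
  rowKernel-trivial {α} {β} {γ} {δ} {c} {d} {c′} {d′} {a} {b} m₁₁ m₁₂ m₂₁ m₂₂ v₁ v₂
    with rowKernel⇒annihilates-det {c} {d} {c′} {d′} {a} {b} v₁ v₂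
  ... | a·detN≡0 , b·detN≡0 = det-cancel a a·detN≡0 , det-cancel b b·detN≡0
    where
    U = (α * δ) * (c * d′) + (β * γ) * (d * c′)
    V = (β * γ) * (c * d′) + (α * δ) * (d * c′)

    1+V≡U : 1# + V ≡ U
    1+V≡U = begin
      1# + V                                    ≡⟨ cong (_+ V) (sym (*-identityˡ 1#)) ⟩
      1# * 1# + V                               ≡⟨ cong₂ (λ s t → s * t + V) (sym m₁₁) (sym m₂₂) ⟩
      (α * c + β * c′) * (γ * d + δ * d′) + V   ≡⟨ solve 8 (λ α β γ δ c d c′ d′ →
          (α :* c :+ β :* c′) :* (γ :* d :+ δ :* d′) :+ ((β :* γ) :* (c :* d′) :+ (α :* δ) :* (d :* c′))
          := (α :* d :+ β :* d′) :* (γ :* c :+ δ :* c′) :+ ((α :* δ) :* (c :* d′) :+ (β :* γ) :* (d :* c′)))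
          refl α β γ δ c d c′ d′ ⟩
      (α * d + β * d′) * (γ * c + δ * c′) + U   ≡⟨ cong (λ s → s * (γ * c + δ * c′) + U) m₁₂ ⟩
      0# * (γ * c + δ * c′) + U                 ≡⟨ trans (cong (_+ U) (zeroˡ _)) (+-identityˡ U) ⟩
      U                                         ∎

    det-cancel : ∀ z → z * (c * d′) ≡ z * (d * c′) → z ≡ 0#
    det-cancel z z·detN≡0 = +-identityˡ-unique z (z * V) (begin
      z + z * V                                            ≡⟨ solve 2 (λ z V → z :+ z :* V := z :* (con 1 :+ V)) refl z V ⟩
      z * (1# + V)                                         ≡⟨ cong (z *_) 1+V≡U ⟩
      z * U                                                ≡⟨ solve 5 (λ z A B C D → z :* (A :* C :+ B :* D)
                                                                := A :* (z :* C) :+ B :* (z :* D)) refl z (α * δ) (β * γ) (c * d′) (d * c′) ⟩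
      (α * δ) * (z * (c * d′)) + (β * γ) * (z * (d * c′))  ≡⟨ cong₂ (λ s t → (α * δ) * s + (β * γ) * t)
                                                                    z·detN≡0 (sym z·detN≡0) ⟩
      (α * δ) * (z * (d * c′)) + (β * γ) * (z * (c * d′))  ≡⟨ solve 5 (λ z A B C D → A :* (z :* D) :+ B :* (z :* C)
                                                                := z :* (B :* C :+ A :* D)) refl z (α * δ) (β * γ) (c * d′) (d * c′) ⟩
      z * V                                                ∎)

  InSpan⇒vanishes : ∀ {p₁ p₂ g y} → InSpan K p₁ p₂ g → p₁ y ≡ 0# → p₂ y ≡ 0# → g y ≡ 0#
  InSpan⇒vanishes {p₁} {p₂} {y = y} (a , b , g≗) p₁y≡0 p₂y≡0 = trans (g≗ y) (lin-vanishes a b {p₁} {p₂} p₁y≡0 p₂y≡0)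

  IsBasisOf⇒Independent : ∀ {f₁ f₂ g₁ g₂} → IsBasisOf K f₁ f₂ g₁ g₂ → Independent f₁ f₂
  IsBasisOf⇒Independent {f₁} {f₂} {g₁} {g₂} ((α , β , g₁≗) , (γ , δ , g₂≗) , C⊆⟨g⟩ , g-independent)
    with C⊆⟨g⟩ 1# 0# | C⊆⟨g⟩ 0# 1#
  ... | c , d , f₁∈⟨g⟩ | c′ , d′ , f₂∈⟨g⟩ = λ a b f≗0 →
    rowKernel-trivial (proj₁ M₁) (proj₂ M₁) (proj₁ M₂) (proj₂ M₂)
      (proj₁ (g-independent _ _ (λ x → trans (sym (in-g a b x)) (f≗0 x))))
      (proj₂ (g-independent _ _ (λ x → trans (sym (in-g a b x)) (f≗0 x))))
    where
    1·u+0·v≡u : ∀ u v → 1# * u + 0# * v ≡ u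
    1·u+0·v≡u u v = trans (cong₂ _+_ (*-identityˡ u) (zeroˡ v)) (+-identityʳ u)
    0·u+1·v≡v : ∀ u v → 0# * u + 1# * v ≡ v
    0·u+1·v≡v u v = trans (cong₂ _+_ (zeroˡ u) (*-identityˡ v)) (+-identityˡ v)
    in-g : ∀ a b x → lin K a f₁ b f₂ x ≡ lin K (a * c + b * c′) g₁ (a * d + b * d′) g₂ x
    in-g a b x = trans
      (cong₂ (λ u v → a * u + b * v) (trans (sym (1·u+0·v≡u (f₁ x) (f₂ x))) (f₁∈⟨g⟩ x))
                                     (trans (sym (0·u+1·v≡v (f₁ x) (f₂ x))) (f₂∈⟨g⟩ x)))
      (solve 8 (λ a b c d c′ d′ u v → a :* (c :* u :+ d :* v) :+ b :* (c′ :* u :+ d′ :* v)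
                                      := (a :* c :+ b :* c′) :* u :+ (a :* d :+ b :* d′) :* v)
             refl a b c d c′ d′ (g₁ x) (g₂ x))
    M₁ : α * c + β * c′ ≡ 1# × α * d + β * d′ ≡ 0#
    M₁ = Independent⇒lin-injective g-independent
           (λ x → trans (sym (in-g α β x)) (trans (sym (g₁≗ x)) (sym (1·u+0·v≡u (g₁ x) (g₂ x)))))
    M₂ : γ * c + δ * c′ ≡ 0# × γ * d + δ * d′ ≡ 1#
    M₂ = Independent⇒lin-injective g-independent
           (λ x → trans (sym (in-g γ δ x)) (trans (sym (g₂≗ x)) (sym (0·u+1·v≡v (g₁ x) (g₂ x)))))

  module Subspaces (F : Subfield K) where
    open Subfield F

    1<subSize : 1 < subSize
    1<subSize = distinct∈⇒1<length 0≢1 (∈-filter⁺ In? (complete 0#) has0) (∈-filter⁺ In? (complete 1#) has1)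

    lin-IsFLinear : ∀ {p₁ p₂} → IsFLinear K F p₁ → IsFLinear K F p₂ → ∀ a b → IsFLinear K F (lin K a p₁ b p₂)
    lin-IsFLinear {p₁} {p₂} (p₁-+ , p₁-*) (p₂-+ , p₂-*) a b = additive , homogeneous
      where
      additive : ∀ x y → lin K a p₁ b p₂ (x + y) ≡ lin K a p₁ b p₂ x + lin K a p₁ b p₂ y
      additive x y = trans (cong₂ (λ s t → a * s + b * t) (p₁-+ x y) (p₂-+ x y))
        (solve 6 (λ a b u₁ u₂ v₁ v₂ → a :* (u₁ :+ u₂) :+ b :* (v₁ :+ v₂) := (a :* u₁ :+ b :* v₁) :+ (a :* u₂ :+ b :* v₂))
               refl a b (p₁ x) (p₁ y) (p₂ x) (p₂ y))
      homogeneous : ∀ c x → In c → lin K a p₁ b p₂ (c * x) ≡ c * lin K a p₁ b p₂ x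
      homogeneous c x c∈F = trans (cong₂ (λ s t → a * s + b * t) (p₁-* c x c∈F) (p₂-* c x c∈F))
        (solve 5 (λ a b c u v → a :* (c :* u) :+ b :* (c :* v) := c :* (a :* u :+ b :* v)) refl a b c (p₁ x) (p₂ x))

    IsFLinear⇒0↦0 : ∀ {h} → IsFLinear K F h → h 0# ≡ 0#
    IsFLinear⇒0↦0 {h} (_ , h-*) = trans (cong h (sym (zeroˡ 0#))) (trans (h-* 0# 0# has0) (zeroˡ (h 0#)))

    record Subspace : Set₁ where
      field
        Member   : Carrier → Set
        member?  : Decidable Member
        0∈       : Member 0#
        +-closed : ∀ {x y} → Member x → Member y → Member (x + y)
        *-closed : ∀ {c x} → In c → Member x → Member (c * x)

      -closed : ∀ {x} → Member x → Member (- x)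
      -closed {x} x∈ = subst Member (-1*x≈-x x) (*-closed (neg-cl has1) x∈)

    open Subspace

    ∣_∣ : Subspace → ℕ
    ∣ W ∣ = count (member? W) elements

    zero-subspace : Subspace
    zero-subspace = record
      { Member   = _≡ 0#
      ; member?  = _≟ 0#
      ; 0∈       = refl
      ; +-closed = λ { refl refl → +-identityˡ 0# }
      ; *-closed = λ { {c} _ refl → zeroʳ c }
      }

    ∣zero-subspace∣ : ∣ zero-subspace ∣ ≡ 1
    ∣zero-subspace∣ = count-exactlyOne (_≟ 0#) refl (λ x≡0 → x≡0)

    -- W + F w, with y ∈ W + F w decided by searching K for a coefficient c ∈ F with y + c w ∈ W
    module Extension (W : Subspace) (w : Carrier) where

      Coefficient : Carrier → Carrier → Set
      Coefficient y c = In c × Member W (y + c * w)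

      coefficient? : ∀ y → Decidable (Coefficient y)
      coefficient? y c = In? c ×-dec member? W (y + c * w)

      extension : Subspace
      extension = record
        { Member   = λ y → Any (Coefficient y) elements
        ; member?  = λ y → any? (coefficient? y) elements
        ; 0∈       = lose (complete 0#) (has0 , subst (Member W) (sym (trans (+-identityˡ _) (zeroˡ w))) (0∈ W))
        ; +-closed = +-closed′
        ; *-closed = *-closed′
        }
        where
        +-closed′ : ∀ {x y} → Any (Coefficient x) elements → Any (Coefficient y) elements →
                    Any (Coefficient (x + y)) elements
        +-closed′ {x} {y} x∈ y∈ with satisfied x∈ | satisfied y∈
        ... | c₁ , c₁∈F , x+c₁w∈W | c₂ , c₂∈F , y+c₂w∈W =
          lose (complete (c₁ + c₂)) (+-cl c₁∈F c₂∈F ,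
            subst (Member W) (solve 5 (λ x y c₁ c₂ w → (x :+ c₁ :* w) :+ (y :+ c₂ :* w) := (x :+ y) :+ (c₁ :+ c₂) :* w)
                                      refl x y c₁ c₂ w)
                  (+-closed W x+c₁w∈W y+c₂w∈W))
        *-closed′ : ∀ {d x} → In d → Any (Coefficient x) elements → Any (Coefficient (d * x)) elements
        *-closed′ {d} {x} d∈F x∈ with satisfied x∈
        ... | c , c∈F , x+cw∈W =
          lose (complete (d * c)) (*-cl d∈F c∈F ,
            subst (Member W) (solve 4 (λ d x c w → d :* (x :+ c :* w) := d :* x :+ (d :* c) :* w) refl d x c w)
                  (*-closed W d∈F x+cw∈W))

      translate-difference : ∀ y c c′ → (y + c * w) + - (y + c′ * w) ≡ (c + - c′) * w
      translate-difference y c c′ = begin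
        (y + c * w) + - (y + c′ * w)        ≡⟨ cong ((y + c * w) +_) (sym (-‿+-comm y (c′ * w))) ⟩
        (y + c * w) + (- y + - (c′ * w))    ≡⟨ cong (λ t → (y + c * w) + (- y + t)) (-‿distribˡ-* c′ w) ⟩
        (y + c * w) + (- y + - c′ * w)      ≡⟨ solve 5 (λ y ny c nc′ w → (y :+ c :* w) :+ (ny :+ nc′ :* w)
                                                         := (y :+ ny) :+ (c :+ nc′) :* w) refl y (- y) c (- c′) w ⟩
        (y + - y) + (c + - c′) * w          ≡⟨ trans (cong (_+ (c + - c′) * w) (-‿inverseʳ y)) (+-identityˡ _) ⟩
        (c + - c′) * w                      ∎

      module _ (w∉W : ¬ Member W w) where

        coefficient-unique : ∀ {y c c′} → Coefficient y c → Coefficient y c′ → c ≡ c′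
        coefficient-unique {y} {c} {c′} (c∈F , y+cw∈W) (c′∈F , y+c′w∈W) with (c + - c′) ≟ 0#
        ... | yes c-c′≡0 = x∙y⁻¹≈ε⇒x≈y c c′ c-c′≡0
        ... | no  c-c′≢0 with inverse (c + - c′) c-c′≢0
        ...   | e , [c-c′]e≡1 = ⊥-elim (w∉W (subst (Member W) e[[c-c′]w]≡w (*-closed W e∈F [c-c′]w∈W)))
          where
          e∈F : In e
          e∈F = inv-cl (+-cl c∈F (neg-cl c′∈F)) [c-c′]e≡1
          [c-c′]w∈W : Member W ((c + - c′) * w)
          [c-c′]w∈W = subst (Member W) (translate-difference y c c′) (+-closed W y+cw∈W (-closed W y+c′w∈W))
          e[[c-c′]w]≡w : e * ((c + - c′) * w) ≡ w
          e[[c-c′]w]≡w = begin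
            e * ((c + - c′) * w)  ≡⟨ sym (*-assoc e _ w) ⟩
            (e * (c + - c′)) * w  ≡⟨ cong (_* w) (trans (*-comm e _) [c-c′]e≡1) ⟩
            1# * w                ≡⟨ *-identityˡ w ⟩
            w                     ∎

        coefficient-count : ∀ y → count (coefficient? y) elements ≡ χ (member? extension y)
        coefficient-count y with any? (coefficient? y) elements
        ... | yes y∈ = count-exactlyOne (coefficient? y) (proj₂ (satisfied y∈))
                         (λ r → coefficient-unique r (proj₂ (satisfied y∈)))
        ... | no  y∉ = count-none (coefficient? y) elements (λ c r → y∉ (lose (complete c) r))

        translate-count : ∀ c → count (λ y → coefficient? y c) elements ≡ χ (In? c) ℕ.* ∣ W ∣
        translate-count c with In? c
        ... | yes c∈F = trans (count-cong _ (λ y → member? W (y + c * w)) elements (λ _ → proj₂) (λ _ m → c∈F , m))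
                              (trans (count-translate (member? W) (c * w)) (sym (ℕ.+-identityʳ ∣ W ∣)))
        ... | no c∉F = count-none _ elements (λ _ r → c∉F (proj₁ r))

        ∣extension∣ : ∣ extension ∣ ≡ subSize ℕ.* ∣ W ∣
        ∣extension∣ = begin
          count (member? extension) elements                      ≡⟨ count≡∑χ (member? extension) elements ⟩
          ∑[ y ∈ elements ] χ (member? extension y)               ≡⟨ ∑-cong elements (λ y → sym (coefficient-count y)) ⟩
          ∑[ y ∈ elements ] count (coefficient? y) elements       ≡⟨ ∑-count-comm coefficient? elements elements ⟩
          ∑[ c ∈ elements ] count (λ y → coefficient? y c) elements ≡⟨ ∑-cong elements translate-count ⟩
          ∑[ c ∈ elements ] (χ (In? c) ℕ.* ∣ W ∣)                 ≡⟨ ∑χ*≡count* In? elements ∣ W ∣ ⟩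
          subSize ℕ.* ∣ W ∣                                       ∎

      extension-⊆ : ∀ {W′ : Subspace} → Member W′ w → (∀ {y} → Member W y → Member W′ y) →
                    ∀ {y} → Member extension y → Member W′ y
      extension-⊆ {W′} w∈W′ W⊆W′ {y} y∈ with satisfied y∈
      ... | c , c∈F , y+cw∈W = subst (Member W′) y+cw-cw≡y (+-closed W′ (W⊆W′ y+cw∈W) (*-closed W′ (neg-cl c∈F) w∈W′))
        where
        y+cw-cw≡y : (y + c * w) + - c * w ≡ y
        y+cw-cw≡y = begin
          (y + c * w) + - c * w  ≡⟨ +-assoc y (c * w) (- c * w) ⟩
          y + (c * w + - c * w)  ≡⟨ cong (y +_) (sym (distribʳ w c (- c))) ⟩
          y + (c + - c) * w      ≡⟨ cong (λ t → y + t * w) (-‿inverseʳ c) ⟩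
          y + 0# * w             ≡⟨ trans (cong (y +_) (zeroˡ w)) (+-identityʳ y) ⟩
          y                      ∎

    module Dimension (q n : ℕ) (|F|≡q : subSize ≡ q) (|K|≡q^n : size ≡ q ^ n) where

      1<q : 1 < q
      1<q = subst (1 <_) |F|≡q 1<subSize

      ^-injective : ∀ {a b} → q ^ a ≡ q ^ b → a ≡ b
      ^-injective {a} {b} q^a≡q^b with ℕ.<-cmp a b
      ... | tri< a<b _ _ = ⊥-elim (ℕ.<-irrefl q^a≡q^b (ℕ.^-monoʳ-< q 1<q a<b))
      ... | tri≈ _ a≡b _ = a≡b
      ... | tri> _ _ b<a = ⊥-elim (ℕ.<-irrefl (sym q^a≡q^b) (ℕ.^-monoʳ-< q 1<q b<a))

      -- Enlarge V ⊆ W one vector at a time; since q ^ j = ∣ V ∣ ≤ q ^ n, at most n steps are possible.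
      grow : ∀ fuel (W V : Subspace) {j} → n < j ℕ.+ fuel → (∀ {y} → Member V y → Member W y) →
             ∣ V ∣ ≡ q ^ j → ∃[ k ] ∣ W ∣ ≡ q ^ k
      grow zero W V {j} n<j+0 _ ∣V∣≡q^j =
        ⊥-elim (ℕ.<⇒≱ (ℕ.^-monoʳ-< q 1<q (subst (n <_) (ℕ.+-identityʳ j) n<j+0))
                      (subst₂ _≤_ ∣V∣≡q^j |K|≡q^n (length-filter (member? V) elements)))
      grow (suc fuel) W V {j} n<j+1+fuel V⊆W ∣V∣≡q^j
        with any? (λ y → member? W y ×-dec ¬? (member? V y)) elements
      ... | no W⊆V = j , trans (count-cong (member? W) (member? V) elements W⇒V (λ _ → V⊆W)) ∣V∣≡q^j
        where
        W⇒V : ∀ y → Member W y → Member V y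
        W⇒V y y∈W with member? V y
        ... | yes y∈V = y∈V
        ... | no  y∉V = ⊥-elim (W⊆V (lose (complete y) (y∈W , y∉V)))
      ... | yes w∈W∖V with satisfied w∈W∖V
      ...   | w , w∈W , w∉V =
        grow fuel W (Extension.extension V w) (subst (n <_) (ℕ.+-suc j fuel) n<j+1+fuel)
             (Extension.extension-⊆ V w {W} w∈W V⊆W)
             (trans (Extension.∣extension∣ V w w∉V) (cong₂ ℕ._*_ |F|≡q ∣V∣≡q^j))

      ∣Subspace∣≡q^ : ∀ W → ∃[ k ] ∣ W ∣ ≡ q ^ k
      ∣Subspace∣≡q^ W = grow (suc n) W zero-subspace {0} (ℕ.n<1+n n)
                             (λ y≡0 → subst (Member W) (sym y≡0) (0∈ W)) ∣zero-subspace∣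

      module _ (h : Carrier → Carrier) (h-linear : IsFLinear K F h) where

        h-+ : ∀ x y → h (x + y) ≡ h x + h y
        h-+ = proj₁ h-linear

        h-* : ∀ c x → In c → h (c * x) ≡ c * h x
        h-* = proj₂ h-linear

        kernel : Subspace
        kernel = record
          { Member   = λ x → h x ≡ 0#
          ; member?  = λ x → h x ≟ 0#
          ; 0∈       = IsFLinear⇒0↦0 h-linear
          ; +-closed = λ {x} {y} hx≡0 hy≡0 → trans (h-+ x y) (trans (cong₂ _+_ hx≡0 hy≡0) (+-identityˡ 0#))
          ; *-closed = λ {c} {x} c∈F hx≡0 → trans (h-* c x c∈F) (trans (cong (c *_) hx≡0) (zeroʳ c))
          }

        image : Subspace
        image = record
          { Member   = _∈ table K h
          ; member?  = _∈? table K h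
          ; 0∈       = subst (_∈ table K h) (IsFLinear⇒0↦0 h-linear) (∈-map⁺ h (complete 0#))
          ; +-closed = +-closed′
          ; *-closed = *-closed′
          }
          where
          +-closed′ : ∀ {y y′} → y ∈ table K h → y′ ∈ table K h → y + y′ ∈ table K h
          +-closed′ y∈ y′∈ with ∈-map⁻ h y∈ | ∈-map⁻ h y′∈
          ... | x , _ , refl | x′ , _ , refl = subst (_∈ table K h) (h-+ x x′) (∈-map⁺ h (complete (x + x′)))
          *-closed′ : ∀ {c y} → In c → y ∈ table K h → c * y ∈ table K h
          *-closed′ {c} c∈F y∈ with ∈-map⁻ h y∈
          ... | x , _ , refl = subst (_∈ table K h) (h-* c x c∈F) (∈-map⁺ h (complete (c * x)))

        fibre-count : ∀ y → count (λ x → h x ≟ y) elements ≡ χ (y ∈? table K h) ℕ.* ∣ kernel ∣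
        fibre-count y with y ∈? table K h
        ... | no  y∉ = count-none (λ x → h x ≟ y) elements
                         (λ x hx≡y → y∉ (subst (_∈ table K h) hx≡y (∈-map⁺ h (complete x))))
        ... | yes y∈ with ∈-map⁻ h y∈
        ...   | x₀ , _ , refl = begin
          count (λ x → h x ≟ h x₀) elements           ≡⟨ sym (count-translate (λ x → h x ≟ h x₀) x₀) ⟩
          count (λ x → h (x + x₀) ≟ h x₀) elements    ≡⟨ count-cong _ (λ x → h x ≟ 0#) elements
                                                           (λ x eq → +-identityˡ-unique (h x) (h x₀) (trans (sym (h-+ x x₀)) eq))
                                                           (λ x hx≡0 → trans (h-+ x x₀) (trans (cong (_+ h x₀) hx≡0) (+-identityˡ (h x₀)))) ⟩
          ∣ kernel ∣                                   ≡⟨ sym (ℕ.+-identityʳ ∣ kernel ∣) ⟩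
          1 ℕ.* ∣ kernel ∣                             ∎

        |K|≡∣image∣*∣kernel∣ : size ≡ ∣ image ∣ ℕ.* ∣ kernel ∣
        |K|≡∣image∣*∣kernel∣ = begin
          length elements                                                 ≡⟨ length≡∑fibres h elements ⟩
          ∑[ y ∈ elements ] count (λ x → h x ≟ y) elements                ≡⟨ ∑-cong elements fibre-count ⟩
          ∑[ y ∈ elements ] (χ (y ∈? table K h) ℕ.* ∣ kernel ∣)           ≡⟨ ∑χ*≡count* (_∈? table K h) elements ∣ kernel ∣ ⟩
          ∣ image ∣ ℕ.* ∣ kernel ∣                                        ∎

        rank-nullity : ∃[ r ] r ≤ n × card K (table K h) ≡ q ^ r × ∣ kernel ∣ ≡ q ^ (n ∸ r)
        rank-nullity with ∣Subspace∣≡q^ image | ∣Subspace∣≡q^ kernel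
        ... | r , ∣image∣≡q^r | k , ∣kernel∣≡q^k =
          r , subst (r ≤_) (sym n≡r+k) (ℕ.m≤m+n r k) , trans (card≡count-∈ (table K h)) ∣image∣≡q^r ,
          trans ∣kernel∣≡q^k (cong (q ^_) (sym (trans (cong (_∸ r) n≡r+k) (ℕ.m+n∸m≡n r k))))
          where
          n≡r+k : n ≡ r ℕ.+ k
          n≡r+k = ^-injective (begin
            q ^ n                   ≡⟨ sym |K|≡q^n ⟩
            size                    ≡⟨ |K|≡∣image∣*∣kernel∣ ⟩
            ∣ image ∣ ℕ.* ∣ kernel ∣ ≡⟨ cong₂ ℕ._*_ ∣image∣≡q^r ∣kernel∣≡q^k ⟩
            q ^ r ℕ.* q ^ k         ≡⟨ sym (ℕ.^-distribˡ-+-* q r k) ⟩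
            q ^ (r ℕ.+ k)           ∎)

module TwoDimensionalCode
  (K : FiniteField) (F : Subfield K) (q n : ℕ)
  (|F|≡q : Subfield.subSize F ≡ q) (|K|≡q^n : FiniteField.size K ≡ q ^ n)
  (f₁ f₂ : FiniteField.Carrier K → FiniteField.Carrier K)
  (f₁-linear : IsFLinear K F f₁) (f₂-linear : IsFLinear K F f₂)
  (g₁ g₂ : FiniteField.Carrier K → FiniteField.Carrier K)
  (basis : IsBasisOf K f₁ f₂ g₁ g₂) (rank-n : HasRankLS K q n g₁ g₂) where

  open import Data.Nat as ℕ using (suc; _∸_; _≤_; s≤s; NonZero)
  import Data.Nat.Properties as ℕ
  open import Data.Nat.Tactic.RingSolver using (solve-∀)
  open import Data.List using (List; length; map; concatMap; cartesianProductWith)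
  import Data.List.Properties as List
  open import Data.List.Relation.Unary.Unique.Propositional.Properties using (cartesianProductWith⁺)
  open import Data.Product using (_×_; _,_; proj₁; proj₂)
  import Data.Product.Properties as Product
  open import Data.Empty using (⊥)
  open import Relation.Nullary using (no; yes)
  open import Relation.Binary.PropositionalEquality
    using (_≢_; sym; trans; cong; cong₂; subst; module ≡-Reasoning)
  open import Defs using (A; gauss1; sumBelow)
  open ≡-Reasoning
  open FiniteField K
  open ListCounting
  open Enumerations _≟_ elements complete unique
  open FieldLinearAlgebra K
  open Subspaces F
  open Dimension q n |F|≡q |K|≡q^n
  open import Algebra.Bundles using (CommutativeRing)
  open CommutativeRing commutativeRing using (+-comm)

  p : ℕ
  p = q ∸ 1

  1≤q : 1 ≤ q
  1≤q = ℕ.<⇒≤ 1<q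

  h : Carrier → Carrier → Carrier → Carrier
  h a b = lin K a f₁ b f₂

  h-linear : ∀ a b → IsFLinear K F (h a b)
  h-linear = lin-IsFLinear f₁-linear f₂-linear

  rk : Carrier → Carrier → ℕ
  rk a b = proj₁ (rank-nullity (h a b) (h-linear a b))

  rk≤n : ∀ a b → rk a b ≤ n
  rk≤n a b = proj₁ (proj₂ (rank-nullity (h a b) (h-linear a b)))

  card≡q^rk : ∀ a b → card K (table K (h a b)) ≡ q ^ rk a b
  card≡q^rk a b = proj₁ (proj₂ (proj₂ (rank-nullity (h a b) (h-linear a b))))

  ∣kernel∣≡q^[n∸rk] : ∀ a b → ∣ kernel (h a b) (h-linear a b) ∣ ≡ q ^ (n ∸ rk a b)
  ∣kernel∣≡q^[n∸rk] a b = proj₂ (proj₂ (proj₂ (rank-nullity (h a b) (h-linear a b))))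

  f-jointly-nonzero : ∀ {x} → x ≢ 0# → f₁ x ≡ 0# → f₂ x ≡ 0# → ⊥
  f-jointly-nonzero {x} x≢0 f₁x≡0 f₂x≡0 =
    x≢0 (Unique-map⇒injectiveOn φ φ-unique (complete x) (complete 0#)
           (trans (φ≡0 f₁x≡0 f₂x≡0) (sym (φ≡0 (IsFLinear⇒0↦0 f₁-linear) (IsFLinear⇒0↦0 f₂-linear)))))
    where
    φ : Carrier → Carrier × Carrier
    φ y = g₁ y , g₂ y
    φ-unique : Unique (map φ elements)
    φ-unique = length-deduplicate≡⇒Unique (Product.≡-dec _≟_ _≟_) (map φ elements)
                 (trans rank-n (trans (sym |K|≡q^n) (sym (List.length-map φ elements))))
    φ≡0 : ∀ {y} → f₁ y ≡ 0# → f₂ y ≡ 0# → φ y ≡ (0# , 0#)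
    φ≡0 f₁y≡0 f₂y≡0 = cong₂ _,_ (InSpan⇒vanishes (proj₁ basis) f₁y≡0 f₂y≡0)
                                (InSpan⇒vanishes (proj₁ (proj₂ basis)) f₁y≡0 f₂y≡0)

  A≡∑∑χ : ∀ i → A K q f₁ f₂ i ≡ ∑[ a ∈ elements ] ∑[ b ∈ elements ] χ (rk a b ℕ.≟ i)
  A≡∑∑χ i = begin
    count P? (elementsC K f₁ f₂)            ≡⟨ cong (count P?) (Unique⇒deduplicate≡id (List.≡-dec _≟_) tables-unique) ⟩
    count P? (concatMap tablesFor elements) ≡⟨ count≡∑χ P? (concatMap tablesFor elements) ⟩
    ∑ (concatMap tablesFor elements) χP     ≡⟨ ∑-concatMap tablesFor elements χP ⟩
    ∑[ a ∈ elements ] ∑ (tablesFor a) χP    ≡⟨ ∑-cong elements (λ a → ∑-map (T a) elements χP) ⟩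
    ∑[ a ∈ elements ] ∑[ b ∈ elements ] χP (T a b)
      ≡⟨ ∑-cong elements (λ a → ∑-cong elements (λ b →
           χ-cong (P? (T a b)) (rk a b ℕ.≟ i) (λ eq → ^-injective (trans (sym (card≡q^rk a b)) eq))
                                              (λ eq → trans (card≡q^rk a b) (cong (q ^_) eq)))) ⟩
    ∑[ a ∈ elements ] ∑[ b ∈ elements ] χ (rk a b ℕ.≟ i) ∎
    where
    P? = λ t → card K t ℕ.≟ q ^ i
    χP = λ t → χ (P? t)
    T : Carrier → Carrier → List Carrier
    T a b = table K (h a b)
    tablesFor : Carrier → List (List Carrier)
    tablesFor a = map (T a) elements
    tables-unique : Unique (concatMap tablesFor elements)
    tables-unique = subst Unique (sym (concatMap-map≡cartesianProductWith T elements elements))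
      (cartesianProductWith⁺ T
        (λ Tab≡Ta′b′ → Independent⇒lin-injective (IsBasisOf⇒Independent basis)
                         (λ x → map≡map⇒pointwise _ _ Tab≡Ta′b′ (complete x)))
        unique unique)

  vanishing-pairs : Carrier → ℕ
  vanishing-pairs x = ∑[ a ∈ elements ] count (λ b → h a b x ≟ 0#) elements

  ∑[1]≡size : ∑[ x ∈ elements ] 1 ≡ size
  ∑[1]≡size = trans (∑-const elements 1) (ℕ.*-identityʳ size)

  vanishing-pairs-at-0 : vanishing-pairs 0# ≡ size ℕ.* size
  vanishing-pairs-at-0 = trans
    (∑-cong elements (λ a → count-all _ elements
      (λ b → lin-vanishes a b {f₁} {f₂} (IsFLinear⇒0↦0 f₁-linear) (IsFLinear⇒0↦0 f₂-linear))))
    (∑-const elements size)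

  vanishing-pairs-off-0 : ∀ x → x ≢ 0# → vanishing-pairs x ≡ size
  vanishing-pairs-off-0 x x≢0 with f₂ x ≟ 0#
  ... | no f₂x≢0  = trans (∑-cong elements (λ a → count-affineRoots (a * f₁ x) f₂x≢0)) ∑[1]≡size
  ... | yes f₂x≡0 = begin
    vanishing-pairs x                                            ≡⟨ ∑-count-comm (λ a b → h a b x ≟ 0#) elements elements ⟩
    ∑[ b ∈ elements ] count (λ a → h a b x ≟ 0#) elements ≡⟨ ∑-cong elements (λ b →
      trans (count-cong _ (λ a → (b * f₂ x + a * f₁ x) ≟ 0#) elements (λ _ → trans (+-comm _ _)) (λ _ → trans (+-comm _ _)))
            (count-affineRoots (b * f₂ x) (λ f₁x≡0 → f-jointly-nonzero x≢0 f₁x≡0 f₂x≡0))) ⟩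
    ∑[ b ∈ elements ] 1                                    ≡⟨ ∑[1]≡size ⟩
    size                                                   ∎

  -- |K|² + (|K| - 1) |K|, with |K| moved to the left to avoid the subtraction.
  ∑∑∣kernel∣-by-roots : ∑[ a ∈ elements ] ∑[ b ∈ elements ] ∣ kernel (h a b) (h-linear a b) ∣ ℕ.+ size
                        ≡ size ℕ.* size ℕ.+ size ℕ.* size
  ∑∑∣kernel∣-by-roots = begin
    ∑[ a ∈ elements ] ∑[ b ∈ elements ] count (λ x → h a b x ≟ 0#) elements ℕ.+ size
      ≡⟨ cong (ℕ._+ size) (trans (∑-cong elements (λ a → ∑-count-comm (λ b x → h a b x ≟ 0#) elements elements))
                                 (∑-comm elements elements _)) ⟩
    ∑[ x ∈ elements ] vanishing-pairs x ℕ.+ size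
      ≡⟨ ∑-constExcept vanishing-pairs unique (complete 0#) vanishing-pairs-off-0 ⟩
    size ℕ.* size ℕ.+ vanishing-pairs 0#
      ≡⟨ cong (size ℕ.* size ℕ.+_) vanishing-pairs-at-0 ⟩
    size ℕ.* size ℕ.+ size ℕ.* size ∎

  ∑∑∣kernel∣-by-ranks : ∑[ a ∈ elements ] ∑[ b ∈ elements ] ∣ kernel (h a b) (h-linear a b) ∣
                        ≡ p ℕ.* ∑[ a ∈ elements ] ∑[ b ∈ elements ] gauss1 (n ∸ rk a b) q ℕ.+ size ℕ.* size
  ∑∑∣kernel∣-by-ranks = begin
    ∑[ a ∈ elements ] ∑[ b ∈ elements ] ∣ kernel (h a b) (h-linear a b) ∣
      ≡⟨ ∑-cong elements (λ a → ∑-cong elements (λ b →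
           trans (∣kernel∣≡q^[n∸rk] a b) (pow≡*gauss1+1 (n ∸ rk a b) 1≤q))) ⟩
    ∑[ a ∈ elements ] ∑[ b ∈ elements ] (p ℕ.* G a b ℕ.+ 1)
      ≡⟨ ∑-cong elements (λ a →
           trans (∑-affine elements (G a) 1) (cong (p ℕ.* ∑ elements (G a) ℕ.+_) (ℕ.*-identityʳ size))) ⟩
    ∑[ a ∈ elements ] (p ℕ.* ∑ elements (G a) ℕ.+ size)
      ≡⟨ ∑-affine elements (λ a → ∑ elements (G a)) size ⟩
    p ℕ.* ∑[ a ∈ elements ] ∑ elements (G a) ℕ.+ size ℕ.* size ∎
    where
    G : Carrier → Carrier → ℕ
    G a b = gauss1 (n ∸ rk a b) q
    ∑-affine : ∀ (xs : List Carrier) (f : Carrier → ℕ) c →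
               ∑[ x ∈ xs ] (p ℕ.* f x ℕ.+ c) ≡ p ℕ.* ∑ xs f ℕ.+ length xs ℕ.* c
    ∑-affine xs f c =
      trans (∑-distrib-+ xs (λ x → p ℕ.* f x) (λ _ → c)) (cong₂ ℕ._+_ (∑-distribˡ-* xs f p) (∑-const xs c))

  ∑∑gauss1≡size*gauss1 : ∑[ a ∈ elements ] ∑[ b ∈ elements ] gauss1 (n ∸ rk a b) q ≡ size ℕ.* gauss1 n q
  ∑∑gauss1≡size*gauss1 = ℕ.*-cancelˡ-≡ X (size ℕ.* gauss1 n q) p {{p≢0}} (ℕ.+-cancelʳ-≡ size _ _ (begin
    p ℕ.* X ℕ.+ size                        ≡⟨ ℕ.+-cancelˡ-≡ (size ℕ.* size) _ _ counted-twice ⟩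
    size ℕ.* size                           ≡⟨ cong (size ℕ.*_) (trans |K|≡q^n (pow≡*gauss1+1 n 1≤q)) ⟩
    size ℕ.* (p ℕ.* gauss1 n q ℕ.+ 1)        ≡⟨ expand size p (gauss1 n q) ⟩
    p ℕ.* (size ℕ.* gauss1 n q) ℕ.+ size     ∎))
    where
    X = ∑[ a ∈ elements ] ∑[ b ∈ elements ] gauss1 (n ∸ rk a b) q
    p≢0 : NonZero p
    p≢0 = ℕ.>-nonZero (ℕ.m<n⇒0<n∸m 1<q)
    rearrange : ∀ x y z → x ℕ.+ (y ℕ.+ z) ≡ y ℕ.+ x ℕ.+ z
    rearrange = solve-∀
    expand : ∀ s p g → s ℕ.* (p ℕ.* g ℕ.+ 1) ≡ p ℕ.* (s ℕ.* g) ℕ.+ s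
    expand = solve-∀
    counted-twice : size ℕ.* size ℕ.+ (p ℕ.* X ℕ.+ size) ≡ size ℕ.* size ℕ.+ size ℕ.* size
    counted-twice = begin
      size ℕ.* size ℕ.+ (p ℕ.* X ℕ.+ size)   ≡⟨ rearrange (size ℕ.* size) (p ℕ.* X) size ⟩
      p ℕ.* X ℕ.+ size ℕ.* size ℕ.+ size     ≡⟨ cong (ℕ._+ size) (sym ∑∑∣kernel∣-by-ranks) ⟩
      ∑[ a ∈ elements ] ∑[ b ∈ elements ] ∣ kernel (h a b) (h-linear a b) ∣ ℕ.+ size ≡⟨ ∑∑∣kernel∣-by-roots ⟩
      size ℕ.* size ℕ.+ size ℕ.* size        ∎

  weighted-rank-count : sumBelow (suc n) (λ i → A K q f₁ f₂ i ℕ.* gauss1 (n ∸ i) q) ≡ size ℕ.* gauss1 n q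
  weighted-rank-count = begin
    sumBelow (suc n) (λ i → A K q f₁ f₂ i ℕ.* G i)
      ≡⟨ sumBelow-cong (suc n) (λ i → cong (ℕ._* G i) (A≡∑∑χ i)) ⟩
    sumBelow (suc n) (λ i → (∑[ a ∈ elements ] ∑[ b ∈ elements ] χ (rk a b ℕ.≟ i)) ℕ.* G i)
      ≡⟨ sumBelow-cong (suc n) (λ i → sym (∑-distribʳ-* elements _ (G i))) ⟩
    sumBelow (suc n) (λ i → ∑[ a ∈ elements ] ((∑[ b ∈ elements ] χ (rk a b ℕ.≟ i)) ℕ.* G i))
      ≡⟨ sym (∑-sumBelow-comm elements (suc n) _) ⟩
    ∑[ a ∈ elements ] sumBelow (suc n) (λ i → (∑[ b ∈ elements ] χ (rk a b ℕ.≟ i)) ℕ.* G i)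
      ≡⟨ sym (∑-cong elements (λ a → ∑-groupBy elements (suc n) (rk a) G (λ b → s≤s (rk≤n a b)))) ⟩
    ∑[ a ∈ elements ] ∑[ b ∈ elements ] G (rk a b)
      ≡⟨ ∑∑gauss1≡size*gauss1 ⟩
    size ℕ.* gauss1 n q ∎
    where
    G : ℕ → ℕ
    G i = gauss1 (n ∸ i) q

open import Defs
open import Data.Nat using (ℕ; _∸_; _^_; _*_)
open import Data.Integer using (ℤ; +_; _-_; _+_)
open import Data.Product using (Σ; _×_; _,_)
open import Relation.Binary.PropositionalEquality using (_≡_)
open import Data.Nat using (zero; suc; _≤_; _<_)
import Data.Nat as ℕ
import Data.Nat.Properties as ℕ
open import Data.Integer.Properties using (pos-+)
open import Data.Integer.Tactic.RingSolver using (solve-∀)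
open import Data.Empty using (⊥-elim)
open import Relation.Binary.PropositionalEquality using (refl; sym; trans; cong; cong₂; subst; module ≡-Reasoning)

-- The top two terms of the weighted sum are a m · [1]_q = a m and a (m + 1) · [0]_q = 0.
last-coefficient : ∀ m (a : ℕ → ℕ) q s → 1 ≤ s →
  sumBelow (suc (suc m)) (λ i → a i * gauss1 (suc m ∸ i) q) ≡ s * gauss1 (suc m) q →
  + a m ≡ (+ ((s ∸ 1) * gauss1 (suc m) q) - + sumBelow m (λ i → a i * gauss1 (suc m ∸ i) q)) + + gauss1 (suc m) q
last-coefficient m a q (suc s) _ weighted = begin
  + a m                      ≡⟨ shift (+ S) (+ a m) ⟩
  (+ S + + a m) - + S        ≡⟨ cong (_- + S) (sym (pos-+ S (a m))) ⟩
  + (S ℕ.+ a m) - + S        ≡⟨ cong (λ t → + t - + S) S+am≡g+sg ⟩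
  + (g ℕ.+ s * g) - + S      ≡⟨ cong (_- + S) (pos-+ g (s * g)) ⟩
  (+ g + + (s * g)) - + S    ≡⟨ regroup (+ g) (+ (s * g)) (+ S) ⟩
  (+ (s * g) - + S) + + g    ∎
  where
  open ≡-Reasoning
  g = gauss1 (suc m) q
  S = sumBelow m (λ i → a i * gauss1 (suc m ∸ i) q)
  shift : ∀ x y → y ≡ (x + y) - x
  shift = solve-∀
  regroup : ∀ x y z → (x + y) - z ≡ (y - z) + x
  regroup = solve-∀
  top : a m * gauss1 (suc m ∸ m) q ≡ a m
  top = trans (cong (λ k → a m * gauss1 k q) (trans (ℕ.+-∸-assoc 1 (ℕ.≤-refl {m})) (cong suc (ℕ.n∸n≡0 m))))
              (ℕ.*-identityʳ (a m))
  beyond : a (suc m) * gauss1 (m ∸ m) q ≡ 0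
  beyond = trans (cong (λ k → a (suc m) * gauss1 k q) (ℕ.n∸n≡0 m)) (ℕ.*-zeroʳ (a (suc m)))
  S+am≡g+sg : S ℕ.+ a m ≡ g ℕ.+ s * g
  S+am≡g+sg = begin
    S ℕ.+ a m                                                         ≡⟨ sym (ℕ.+-identityʳ _) ⟩
    S ℕ.+ a m ℕ.+ 0                                                   ≡⟨ cong₂ (λ u v → S ℕ.+ u ℕ.+ v) (sym top) (sym beyond) ⟩
    S ℕ.+ a m * gauss1 (suc m ∸ m) q ℕ.+ a (suc m) * gauss1 (m ∸ m) q ≡⟨ weighted ⟩
    g ℕ.+ s * g                                                       ∎

mainTheorem16 : (K : FiniteField) (F : Subfield K) (q n : ℕ) →
    Subfield.subSize F ≡ q → FiniteField.size K ≡ q ^ n →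
    (f₁ f₂ : FiniteField.Carrier K → FiniteField.Carrier K) →
    IsFLinear K F f₁ → IsFLinear K F f₂ →
    Σ (FiniteField.Carrier K → FiniteField.Carrier K) (λ g₁ →
      Σ (FiniteField.Carrier K → FiniteField.Carrier K) (λ g₂ →
        IsBasisOf K f₁ f₂ g₁ g₂ × IsProper K g₁ g₂ × HasRankLS K q n g₁ g₂)) →
    + A K q f₁ f₂ (n ∸ 1)
      ≡ (+ ((q ^ n ∸ 1) * gauss1 n q)
         - + sumBelow (n ∸ 1) (λ i → A K q f₁ f₂ i * gauss1 (n ∸ i) q))
        + + gauss1 n q
mainTheorem16 K F q zero _ |K|≡1 _ _ _ _ _ =
  ⊥-elim (ℕ.<-irrefl refl (subst (1 <_) |K|≡1 (FieldLinearAlgebra.1<size K)))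
mainTheorem16 K F q n@(suc m) |F|≡q |K|≡q^n f₁ f₂ f₁-linear f₂-linear (g₁ , g₂ , basis , _ , rank-n) =
  last-coefficient m (A K q f₁ f₂) q (q ^ n) (subst (1 ≤_) |K|≡q^n (ℕ.<⇒≤ (FieldLinearAlgebra.1<size K)))
    (trans weighted-rank-count (cong (_* gauss1 n q) |K|≡q^n))
  where open TwoDimensionalCode K F q n |F|≡q |K|≡q^n f₁ f₂ f₁-linear f₂-linear g₁ g₂ basis rank-n
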